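{- Let $G$ be a finite, simple, connected graph with at least one edge, on vertex set $\{1,\dots,N\}$, and let $\nabla_G=\{\pm(\mathbf e_i-\mathbf e_j)\mid \{i,j\}\in\mathcal E(G)\}\subset\mathbb R^N$. Then the number of facets of the polytope $\operatorname{conv}(\nabla_G)$ is at most $\beta\cdot 2^{N-1}$, where $\beta$ is the number of maximal bipartite subgraphs of $G$.
   Context: $\mathbf e_1,\dots,\mathbf e_N$ is the standard basis of $\mathbb R^N$. A maximal bipartite subgraph of $G$ is a bipartite subgraph that is maximal under inclusion among bipartite subgraphs of $G$. -}

module Defs where

open import Data.Nat using (ℕ)
open import Data.Bool using (Bool; true; false)
open import Data.Fin using (Fin)
open import Data.Vec using (Vec; lookup)
open import Data.Integer using (ℤ; _-_; _≤_)
open import Data.Product using (Σ; ∃; _×_; _,_)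
open import Relation.Binary.PropositionalEquality using (_≡_; _≢_)
open import Relation.Binary.Construct.Closure.ReflexiveTransitive using (Star)
open import Function.Bundles using (_⇔_)

-- A graph / edge set / set of ordered pairs on vertices Fin N,
-- given by its Boolean adjacency matrix.
Mat : ℕ → Set
Mat N = Vec (Vec Bool N) N

_∋⟨_,_⟩ : ∀ {N} → Mat N → Fin N → Fin N → Set
A ∋⟨ i , j ⟩ = lookup (lookup A i) j ≡ true

IsSimple : ∀ {N} → Mat N → Set
IsSimple {N} A = (∀ (i j : Fin N) → A ∋⟨ i , j ⟩ → A ∋⟨ j , i ⟩)
               × (∀ (i : Fin N) → lookup (lookup A i) i ≡ false)

Adj : ∀ {N} → Mat N → Fin N → Fin N → Set
Adj A i j = A ∋⟨ i , j ⟩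

IsConnected : ∀ {N} → Mat N → Set
IsConnected {N} A = ∀ (i j : Fin N) → Star (Adj A) i j

HasEdge : ∀ {N} → Mat N → Set
HasEdge {N} A = Σ (Fin N) λ i → Σ (Fin N) λ j → A ∋⟨ i , j ⟩

_⊆ᴹ_ : ∀ {N} → Mat N → Mat N → Set
_⊆ᴹ_ {N} A B = ∀ (i j : Fin N) → A ∋⟨ i , j ⟩ → B ∋⟨ i , j ⟩

IsSubgraph : ∀ {N} → Mat N → Mat N → Set
IsSubgraph H G = IsSimple H × (H ⊆ᴹ G)

IsBipartite : ∀ {N} → Mat N → Set
IsBipartite {N} H = Σ (Fin N → Bool) λ c → ∀ (i j : Fin N) → H ∋⟨ i , j ⟩ → c i ≢ c j

IsMaximalBipartiteSubgraph : ∀ {N} → Mat N → Mat N → Set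
IsMaximalBipartiteSubgraph G H =
  IsSubgraph H G × IsBipartite H ×
  (∀ H' → IsSubgraph H' G → IsBipartite H' → H ⊆ᴹ H' → H' ≡ H)

-- ∇_G = { e_i - e_j | G ∋ (i,j) }  (both orientations since G is symmetric).
-- A set of points of ∇_G is encoded by a Mat N: F ∋ (i,j) means e_i - e_j ∈ F.
-- The linear functional a (integer coefficients) evaluates to a i - a j on e_i - e_j.
-- A face of conv(∇_G), recorded by the vertices (points of ∇_G) it contains:
-- F = {v ∈ ∇_G | a·v = c} for a valid inequality a·x ≤ c of conv(∇_G).
IsFace : ∀ {N} → Mat N → Mat N → Set
IsFace {N} G F =
  Σ (Fin N → ℤ) λ a → Σ ℤ λ c →
    (∀ (i j : Fin N) → G ∋⟨ i , j ⟩ → a i - a j ≤ c) ×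
    (∀ (i j : Fin N) → F ∋⟨ i , j ⟩ ⇔ (G ∋⟨ i , j ⟩ × a i - a j ≡ c))

IsProperFace : ∀ {N} → Mat N → Mat N → Set
IsProperFace {N} G F =
  IsFace G F × Σ (Fin N) λ i → Σ (Fin N) λ j → G ∋⟨ i , j ⟩ × lookup (lookup F i) j ≡ false

IsFacet : ∀ {N} → Mat N → Mat N → Set
IsFacet G F = IsProperFace G F × (∀ F' → IsProperFace G F' → F ⊆ᴹ F' → F' ≡ F)

-- Every facet of conv(∇_G) is cut out by an inequality a·x ≤ c with c > 0; rescaling a by c
-- and rounding down gives a potential k : V → ℕ with |k i − k j| ≤ 1 along edges whose facet
-- is the set of tight edges (i , j), those with k i = k j + 1.  The edges on which k is not
-- constant form a maximal bipartite subgraph H (colour by the parity of k): if H' ⊇ H is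
-- bipartite, raising k by one where the parity of k and the colouring of H' disagree gives a
-- potential whose facet contains that of k, and differs from it unless H' = H.
-- Finally, for connected G the facet of k is determined by H together with one bit per non-root
-- vertex v, namely whether k v − k root is 2 or 3 modulo 4: walking out from the root, each
-- edge of H changes k by ±1 and the bit at its far end tells which.
module Submission where

open import Defs
open import Data.Nat using (ℕ; _*_; _^_; _∸_; _≤_)
open import Data.List using (List; length)
open import Data.List.Relation.Unary.All using (All)
open import Data.List.Relation.Unary.Unique.Propositional using (Unique)
open import Data.List.Membership.Propositional using (_∈_)
open import Data.Product using (_×_)
open import Function.Bundles using (_⇔_)

open import Data.Nat using (zero; suc; _+_; z≤n; s≤s; NonZero; _≟_)
open import Data.Nat.Properties
  using (suc-injective; 1+n≢n; m≢1+n+m; +-comm; +-cancelʳ-≡; n≤1+n; ≤-refl; ≤-trans; m≤m+n; m+n∸m≡n)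
open import Data.Nat.DivMod using (_/_; /-monoˡ-≤; m/n≡1+[m∸n]/n)
open import Data.Nat.Tactic.RingSolver using (solve-∀)
open import Data.Integer as ℤ using (ℤ; +_; -[1+_]; 0ℤ; +≤+)
import Data.Integer.Properties as ℤₚ
import Data.Integer.Tactic.RingSolver as ℤ-Ring
open import Data.Bool using (Bool; true; false; not; _∧_; _xor_; if_then_else_)
open import Data.Bool.Properties using (¬-not; not-¬; not-injective; not-involutive)
open import Data.Fin using (Fin; zero; suc; combine; funToFin; finToFun)
open import Data.Fin.Properties using (combine-injective; finToFun-funToFin; injective⇒≤)
open import Data.Vec using (Vec; lookup; tabulate)
open import Data.Vec.Properties using (lookup∘tabulate; tabulate∘lookup; tabulate-cong)
import Data.List as List
import Data.List.Relation.Unary.All as All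
open import Data.List.Relation.Unary.AllPairs using (_∷_)
open import Data.List.Relation.Unary.Any using (index)
open import Data.List.Relation.Unary.Any.Properties using (lookup-index)
open import Data.List.Membership.Propositional.Properties using (∈-lookup)
open import Data.Product using (∃; _,_; proj₁; proj₂)
open import Data.Sum using (_⊎_; inj₁; inj₂)
open import Data.Empty using (⊥-elim)
open import Relation.Nullary using (¬_; Dec; yes; no; contradiction)
open import Relation.Nullary.Decidable using (⌊_⌋; ¬?; decidable-stable)
open import Relation.Binary.Definitions using (Decidable)
open import Relation.Binary.PropositionalEquality
open import Relation.Binary.Construct.Closure.ReflexiveTransitive using (Star; ε; _◅_)
open import Function using (_∘_; id)
open import Function.Bundles using (mk⇔; Equivalence)

open Equivalence using (to; from)

≡true-ext : ∀ {x y : Bool} → (x ≡ true → y ≡ true) → (y ≡ true → x ≡ true) → x ≡ y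
≡true-ext {false} {false} _ _ = refl
≡true-ext {false} {true} _ y⇒x = y⇒x refl
≡true-ext {true} x⇒y _ = sym (x⇒y refl)

∧-⌊⌋≡true : ∀ {P : Set} {b} (P? : Dec P) → b ∧ ⌊ P? ⌋ ≡ true ⇔ (b ≡ true × P)
∧-⌊⌋≡true {b = false} _ = mk⇔ (λ ()) (λ { (() , _) })
∧-⌊⌋≡true {b = true} (yes p) = mk⇔ (λ _ → refl , p) (λ _ → refl)
∧-⌊⌋≡true {b = true} (no ¬p) = mk⇔ (λ ()) (λ (_ , p) → contradiction p ¬p)

not-xor-not : ∀ x y → not x xor not y ≡ x xor y
not-xor-not true y = refl
not-xor-not false y = not-involutive y

xor-≢-≢ : ∀ {a b c d} → a ≢ b → c ≢ d → a xor c ≡ b xor d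
xor-≢-≢ {b = b} {d = d} a≢b c≢d rewrite ¬-not a≢b | ¬-not c≢d = not-xor-not b d

xor-cancelˡ : ∀ a {c d} → a xor c ≡ a xor d → c ≡ d
xor-cancelˡ true = not-injective
xor-cancelˡ false c≡d = c≡d

Adjacent : ℕ → ℕ → Set
Adjacent m n = m ≡ suc n ⊎ n ≡ suc m

adjacent : ∀ {m n} → m ≤ suc n → n ≤ suc m → m ≢ n → Adjacent m n
adjacent {zero} {zero} _ _ m≢n = contradiction refl m≢n
adjacent {zero} {suc zero} _ _ _ = inj₂ refl
adjacent {zero} {suc (suc n)} _ (s≤s ()) _
adjacent {suc zero} {zero} _ _ _ = inj₁ refl
adjacent {suc (suc m)} {zero} (s≤s ()) _ _
adjacent {suc m} {suc n} (s≤s m≤1+n) (s≤s n≤1+m) m≢n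
  with adjacent m≤1+n n≤1+m (m≢n ∘ cong suc)
... | inj₁ m≡1+n = inj₁ (cong suc m≡1+n)
... | inj₂ n≡1+m = inj₂ (cong suc n≡1+m)

adjacent⇒≢ : ∀ {m n} → Adjacent m n → m ≢ n
adjacent⇒≢ (inj₁ m≡1+n) m≡n = 1+n≢n (trans (sym m≡1+n) m≡n)
adjacent⇒≢ (inj₂ n≡1+m) m≡n = 1+n≢n (trans (sym n≡1+m) (sym m≡n))

adjacent-+ : ∀ {m n} s → Adjacent m n → Adjacent (m + s) (n + s)
adjacent-+ s (inj₁ m≡1+n) = inj₁ (cong (_+ s) m≡1+n)
adjacent-+ s (inj₂ n≡1+m) = inj₂ (cong (_+ s) n≡1+m)

adjacent-coincide : ∀ {a b c} → Adjacent a b → Adjacent a c → b ≡ c ⊎ b ≡ 2 + c ⊎ c ≡ 2 + b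
adjacent-coincide (inj₁ a≡1+b) (inj₁ a≡1+c) = inj₁ (suc-injective (trans (sym a≡1+b) a≡1+c))
adjacent-coincide (inj₂ refl) (inj₂ refl) = inj₁ refl
adjacent-coincide (inj₁ refl) (inj₂ refl) = inj₂ (inj₂ refl)
adjacent-coincide (inj₂ refl) (inj₁ refl) = inj₂ (inj₁ refl)

odd : ℕ → Bool
odd zero = false
odd (suc n) = not (odd n)

odd-adjacent : ∀ {m n} → Adjacent m n → odd m ≢ odd n
odd-adjacent (inj₁ refl) = ≢-sym (not-¬ refl)
odd-adjacent (inj₂ refl) = not-¬ refl

raise : Bool → ℕ → ℕ
raise b n = if b then suc n else n

raise-suc : ∀ b n → raise b (suc n) ≡ suc (raise b n)
raise-suc true n = refl
raise-suc false n = refl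

raise-mono : ∀ b {m n} → m ≤ suc n → raise b m ≤ suc (raise b n)
raise-mono true m≤1+n = s≤s m≤1+n
raise-mono false m≤1+n = m≤1+n

raise-level : ∀ b b′ {m n} → m ≡ n → raise b m ≤ suc (raise b′ n)
raise-level true true {m} refl = n≤1+n (suc m)
raise-level true false refl = ≤-refl
raise-level false true {m} refl = ≤-trans (n≤1+n m) (n≤1+n (suc m))
raise-level false false {m} refl = n≤1+n m

raise-≢ : ∀ {b b′ m n} → b ≢ b′ → m ≡ n → Adjacent (raise b m) (raise b′ n)
raise-≢ {true} {true} b≢b′ _ = contradiction refl b≢b′
raise-≢ {true} {false} _ refl = inj₁ refl
raise-≢ {false} {true} _ refl = inj₂ refl
raise-≢ {false} {false} b≢b′ _ = contradiction refl b≢b′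

/-suc : ∀ C {q} .{{_ : NonZero C}} → (C + q) / C ≡ suc (q / C)
/-suc C {q} = trans (m/n≡1+[m∸n]/n (m≤m+n C q)) (cong (λ x → suc (x / C)) (m+n∸m≡n C q))

/-suc-≤ : ∀ C {p q} .{{_ : NonZero C}} → p ≤ C + q → p / C ≤ suc (q / C)
/-suc-≤ C p≤C+q = subst (_ ≤_) (/-suc C) (/-monoˡ-≤ C p≤C+q)

/-suc-≡ : ∀ C {p q} .{{_ : NonZero C}} → p ≡ C + q → p / C ≡ suc (q / C)
/-suc-≡ C refl = /-suc C

data ℤ₄ : Set where
  0₄ 1₄ 2₄ 3₄ : ℤ₄

suc₄ : ℤ₄ → ℤ₄
suc₄ 0₄ = 1₄
suc₄ 1₄ = 2₄
suc₄ 2₄ = 3₄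
suc₄ 3₄ = 0₄

residue : ℕ → ℤ₄
residue zero = 0₄
residue (suc n) = suc₄ (residue n)

half : ℤ₄ → Fin 2
half 0₄ = zero
half 1₄ = zero
half 2₄ = suc zero
half 3₄ = suc zero

residue-*4 : ∀ n → residue (n * 4) ≡ 0₄
residue-*4 zero = refl
residue-*4 (suc n) rewrite residue-*4 n = refl

residue-+*4 : ∀ m n → residue (m + n * 4) ≡ residue m
residue-+*4 zero n = residue-*4 n
residue-+*4 (suc m) n = cong suc₄ (residue-+*4 m n)

residue-rebase : ∀ a s s′ → residue (a + s * 3) ≡ residue ((a + s′) + (s + s′) * 3)
residue-rebase a s s′ = begin
  residue (a + s * 3)                ≡⟨ residue-+*4 (a + s * 3) s′ ⟨
  residue (a + s * 3 + s′ * 4)       ≡⟨ cong residue (regroup a s s′) ⟩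
  residue ((a + s′) + (s + s′) * 3)  ∎
  where
  open ≡-Reasoning
  regroup : ∀ a s s′ → a + s * 3 + s′ * 4 ≡ (a + s′) + (s + s′) * 3
  regroup = solve-∀

half-residue-2+ : ∀ {x y} → x ≡ 2 + y → half (residue x) ≢ half (residue y)
half-residue-2+ {y = y} refl = half-suc₄² (residue y)
  where
  half-suc₄² : ∀ r → half (suc₄ (suc₄ r)) ≢ half r
  half-suc₄² 0₄ ()
  half-suc₄² 1₄ ()
  half-suc₄² 2₄ ()
  half-suc₄² 3₄ ()

-- k v − k r modulo 4; adding k r * 4 avoids truncated subtraction.
level₄ : ∀ {N} → (Fin N → ℕ) → Fin N → Fin N → ℤ₄
level₄ k r v = residue (k v + k r * 3)

level₄-root : ∀ {N} (k : Fin N → ℕ) r → level₄ k r r ≡ 0₄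
level₄-root k r = trans (cong residue (m+m*3≡m*4 (k r))) (residue-*4 (k r))
  where
  m+m*3≡m*4 : ∀ m → m + m * 3 ≡ m * 4
  m+m*3≡m*4 = solve-∀

i-j+j≡i : ∀ i j → i ℤ.- j ℤ.+ j ≡ i
i-j+j≡i = ℤ-Ring.solve-∀

i+j-j≡i : ∀ i j → i ℤ.+ j ℤ.- j ≡ i
i+j-j≡i = ℤ-Ring.solve-∀

j-i≡-[i-j] : ∀ i j → j ℤ.- i ≡ ℤ.- (i ℤ.- j)
j-i≡-[i-j] = ℤ-Ring.solve-∀

m-n≤o⇔m≤o+n : ∀ m n o → + m ℤ.- + n ℤ.≤ + o ⇔ m ≤ o + n
m-n≤o⇔m≤o+n m n o = mk⇔
  (λ h → ℤₚ.drop‿+≤+ (subst (ℤ._≤ + (o + n)) (i-j+j≡i (+ m) (+ n)) (ℤₚ.+-monoˡ-≤ (+ n) h)))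
  (λ h → subst (+ m ℤ.- + n ℤ.≤_) (i+j-j≡i (+ o) (+ n)) (ℤₚ.+-monoˡ-≤ (ℤ.- + n) (+≤+ h)))

m-n≡o⇔m≡o+n : ∀ m n o → + m ℤ.- + n ≡ + o ⇔ m ≡ o + n
m-n≡o⇔m≡o+n m n o = mk⇔
  (λ h → ℤₚ.+-injective (trans (sym (i-j+j≡i (+ m) (+ n))) (cong (ℤ._+ + n) h)))
  (λ h → trans (cong (λ x → + x ℤ.- + n) h) (i+j-j≡i (+ o) (+ n)))

±i≤j⇒0≤j : ∀ {i j} → i ℤ.≤ j → ℤ.- i ℤ.≤ j → 0ℤ ℤ.≤ j
±i≤j⇒0≤j {+ _} i≤j _ = ℤₚ.≤-trans (+≤+ z≤n) i≤j
±i≤j⇒0≤j { -[1+ _ ]} _ -i≤j = ℤₚ.≤-trans (+≤+ z≤n) -i≤j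

±i≤0⇒i≡0 : ∀ {i} → i ℤ.≤ 0ℤ → ℤ.- i ℤ.≤ 0ℤ → i ≡ 0ℤ
±i≤0⇒i≡0 i≤0 -i≤0 = ℤₚ.≤-antisym i≤0 (ℤₚ.neg-cancel-≤ -i≤0)

lowerBound : ∀ {n} (a : Fin n → ℤ) → ∃ λ m → ∀ i → m ℤ.≤ a i
lowerBound {zero} a = 0ℤ , λ ()
lowerBound {suc n} a with m , m≤a ← lowerBound (a ∘ suc) =
  a zero ℤ.⊓ m , λ { zero → ℤₚ.i⊓j≤i (a zero) m
                   ; (suc i) → ℤₚ.≤-trans (ℤₚ.i⊓j≤j (a zero) m) (m≤a i) }

floorScaling : ∀ {n} (a : Fin n → ℤ) (C : ℕ) .{{_ : NonZero C}} →
  ∃ λ (k : Fin n → ℕ) → ∀ i j →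
    (a i ℤ.- a j ℤ.≤ + C → k i ≤ suc (k j)) × (a i ℤ.- a j ≡ + C → k i ≡ suc (k j))
floorScaling {n} a C with m , m≤a ← lowerBound a = (λ i → x i / C) , λ i j →
    (λ h → /-suc-≤ C (to (m-n≤o⇔m≤o+n (x i) (x j) C) (subst (ℤ._≤ + C) (diff i j) h)))
  , (λ h → /-suc-≡ C (to (m-n≡o⇔m≡o+n (x i) (x j) C) (trans (sym (diff i j)) h)))
  where
  x : Fin n → ℕ
  x i = ℤ.∣ a i ℤ.- m ∣
  +x : ∀ i → + x i ≡ a i ℤ.- m
  +x i = ℤₚ.0≤i⇒+∣i∣≡i (ℤₚ.i≤j⇒0≤j-i (m≤a i))
  translate : ∀ u w m → u ℤ.- w ≡ (u ℤ.- m) ℤ.- (w ℤ.- m)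
  translate = ℤ-Ring.solve-∀
  diff : ∀ i j → a i ℤ.- a j ≡ + x i ℤ.- + x j
  diff i j = trans (translate (a i) (a j) m) (sym (cong₂ ℤ._-_ (+x i) (+x j)))

lookup-injective : ∀ {A : Set} {xs : List A} → Unique xs → ∀ {p q} →
  List.lookup xs p ≡ List.lookup xs q → p ≡ q
lookup-injective (_ ∷ _) {zero} {zero} _ = refl
lookup-injective (x≢ ∷ _) {zero} {suc q} x≡ = contradiction x≡ (All.lookup x≢ (∈-lookup q))
lookup-injective (x≢ ∷ _) {suc p} {zero} ≡x = contradiction (sym ≡x) (All.lookup x≢ (∈-lookup p))
lookup-injective (_ ∷ unique) {suc p} {suc q} eq = cong suc (lookup-injective unique eq)

unique⇒length≤ : ∀ {A : Set} {xs : List A} {m} → Unique xs → (code : Fin (length xs) → Fin m) →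
  (∀ {p q} → code p ≡ code q → List.lookup xs p ≡ List.lookup xs q) → length xs ≤ m
unique⇒length≤ unique code faithful = injective⇒≤ (lookup-injective unique ∘ faithful)

∈-index-injective : ∀ {A : Set} {x y : A} {xs} (x∈ : x ∈ xs) (y∈ : y ∈ xs) →
  index x∈ ≡ index y∈ → x ≡ y
∈-index-injective {xs = xs} x∈ y∈ eq =
  trans (lookup-index x∈) (trans (cong (List.lookup xs) eq) (sym (lookup-index y∈)))

lookup-ext : ∀ {A : Set} {n} {xs ys : Vec A n} → (∀ i → lookup xs i ≡ lookup ys i) → xs ≡ ys
lookup-ext {xs = xs} {ys} eq =
  trans (sym (tabulate∘lookup xs)) (trans (tabulate-cong eq) (tabulate∘lookup ys))

module _ {N : ℕ} where

  _⊆ᴹ-antisym_ : {A B : Mat N} → A ⊆ᴹ B → B ⊆ᴹ A → A ≡ B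
  A⊆B ⊆ᴹ-antisym B⊆A = lookup-ext λ i → lookup-ext λ j → ≡true-ext (A⊆B i j) (B⊆A i j)

  restrict : {P : Fin N → Fin N → Set} → Mat N → Decidable P → Mat N
  restrict G P? = tabulate λ i → tabulate λ j → lookup (lookup G i) j ∧ ⌊ P? i j ⌋

  ∈-restrict : ∀ {P} (G : Mat N) (P? : Decidable P) {i j} →
    restrict G P? ∋⟨ i , j ⟩ ⇔ (G ∋⟨ i , j ⟩ × P i j)
  ∈-restrict G P? {i} {j}
    rewrite lookup∘tabulate (λ i → tabulate λ j → lookup (lookup G i) j ∧ ⌊ P? i j ⌋) i
          | lookup∘tabulate (λ j → lookup (lookup G i) j ∧ ⌊ P? i j ⌋) j
    = ∧-⌊⌋≡true (P? i j)

  ∉-restrict : ∀ {P} (G : Mat N) (P? : Decidable P) {i j} → ¬ P i j →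
    lookup (lookup (restrict G P?) i) j ≡ false
  ∉-restrict G P? ¬p = ¬-not (¬p ∘ proj₂ ∘ to (∈-restrict G P?))

module Potentials {N : ℕ} (G : Mat N) (simple : IsSimple G) where

  private
    V : Set
    V = Fin N

    symmetric : ∀ i j → G ∋⟨ i , j ⟩ → G ∋⟨ j , i ⟩
    symmetric = proj₁ simple

  Lipschitz : (V → ℕ) → Set
  Lipschitz k = ∀ i j → G ∋⟨ i , j ⟩ → k i ≤ suc (k j)

  tight? : (k : V → ℕ) → Decidable (λ i j → k i ≡ suc (k j))
  tight? k i j = k i ≟ suc (k j)

  cut? : (k : V → ℕ) → Decidable (λ i j → k i ≢ k j)
  cut? k i j = ¬? (k i ≟ k j)

  tight : (V → ℕ) → Mat N
  tight k = restrict G (tight? k)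

  cut : (V → ℕ) → Mat N
  cut k = restrict G (cut? k)

  ∈tight : ∀ {k i j} → tight k ∋⟨ i , j ⟩ ⇔ (G ∋⟨ i , j ⟩ × k i ≡ suc (k j))
  ∈tight {k} = ∈-restrict G (tight? k)

  ∈cut : ∀ {k i j} → cut k ∋⟨ i , j ⟩ ⇔ (G ∋⟨ i , j ⟩ × k i ≢ k j)
  ∈cut {k} = ∈-restrict G (cut? k)

  record PotentialOf (F : Mat N) : Set where
    field
      k : V → ℕ
      lipschitz : Lipschitz k
      tight-k≡F : tight k ≡ F

  lipschitz-adjacent : ∀ {k i j} → Lipschitz k → G ∋⟨ i , j ⟩ → k i ≢ k j → Adjacent (k i) (k j)
  lipschitz-adjacent lip g = adjacent (lip _ _ g) (lip _ _ (symmetric _ _ g))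

  tight-isFace : ∀ {k} → Lipschitz k → IsFace G (tight k)
  tight-isFace {k} lip =
    (λ i → + k i) , + 1 ,
    (λ i j g → from (m-n≤o⇔m≤o+n (k i) (k j) 1) (lip i j g)) ,
    λ i j → mk⇔ (λ t → let g , e = to ∈tight t in g , from (m-n≡o⇔m≡o+n (k i) (k j) 1) e)
                (λ (g , e) → from ∈tight (g , to (m-n≡o⇔m≡o+n (k i) (k j) 1) e))

  tight-isProperFace : ∀ {k} → HasEdge G → Lipschitz k → IsProperFace G (tight k)
  tight-isProperFace {k} (x , y , g) lip with tight? k x y
  ... | yes kx≡1+ky = tight-isFace lip , y , x , symmetric x y g ,
        ∉-restrict G (tight? k) (λ ky≡1+kx → m≢1+n+m (k x) (trans kx≡1+ky (cong suc ky≡1+kx)))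
  ... | no kx≢1+ky = tight-isFace lip , x , y , g , ∉-restrict G (tight? k) kx≢1+ky

  module _ (a : V → ℤ) {c : ℤ} (valid : ∀ i j → G ∋⟨ i , j ⟩ → a i ℤ.- a j ℤ.≤ c) where

    valid-reversed : ∀ {i j} → G ∋⟨ i , j ⟩ → ℤ.- (a i ℤ.- a j) ℤ.≤ c
    valid-reversed {i} {j} g = subst (ℤ._≤ c) (j-i≡-[i-j] (a i) (a j)) (valid j i (symmetric i j g))

    valid⇒0≤c : HasEdge G → 0ℤ ℤ.≤ c
    valid⇒0≤c (x , y , g) = ±i≤j⇒0≤j (valid x y g) (valid-reversed g)

    valid-c≡0⇒tight : c ≡ 0ℤ → ∀ {i j} → G ∋⟨ i , j ⟩ → a i ℤ.- a j ≡ c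
    valid-c≡0⇒tight refl g = ±i≤0⇒i≡0 (valid _ _ g) (valid-reversed g)

  facet⇒potential : ∀ {F} → HasEdge G → IsFacet G F → PotentialOf F
  facet⇒potential {F} edge (((a , c , valid , F⇔) , i , j , gij , F∌ij) , maximal) with c
  ... | -[1+ _ ] = contradiction (valid⇒0≤c a valid edge) λ ()
  ... | + zero = ⊥-elim (not-¬ (from (F⇔ i j) (gij , valid-c≡0⇒tight a valid refl gij)) F∌ij)
  ... | + suc C with k , scaled ← floorScaling a (suc C) = record
    { k = k
    ; lipschitz = lip
    ; tight-k≡F = maximal (tight k) (tight-isProperFace edge lip) F⊆tight
    }
    where
    lip : Lipschitz k
    lip i j g = proj₁ (scaled i j) (valid i j g)
    F⊆tight : F ⊆ᴹ tight k
    F⊆tight i j f = let g , e = to (F⇔ i j) f in from ∈tight (g , proj₂ (scaled i j) e)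

  cut-isSubgraph : ∀ k → IsSubgraph (cut k) G
  cut-isSubgraph k =
    ( (λ i j c → let g , k≢ = to ∈cut c in from ∈cut (symmetric i j g , ≢-sym k≢))
    , (λ i → ∉-restrict G (cut? k) (λ k≢ → k≢ refl)) )
    , λ i j → proj₁ ∘ to ∈cut

  cut-isBipartite : ∀ {k} → Lipschitz k → IsBipartite (cut k)
  cut-isBipartite {k} lip = odd ∘ k , λ i j c →
    let g , k≢ = to ∈cut c in odd-adjacent (lipschitz-adjacent lip g k≢)

  module Recolouring (edge : HasEdge G) {k} (lip : Lipschitz k) (facet : IsFacet G (tight k))
                     {H} (H⊆G : H ⊆ᴹ G) (χ : V → Bool) (χ-proper : ∀ i j → H ∋⟨ i , j ⟩ → χ i ≢ χ j)
                     (cut⊆H : cut k ⊆ᴹ H) where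

    flip : V → Bool
    flip v = odd (k v) xor χ v

    k′ : V → ℕ
    k′ v = raise (flip v) (k v)

    flip-cut : ∀ {i j} → G ∋⟨ i , j ⟩ → k i ≢ k j → flip i ≡ flip j
    flip-cut g k≢ = xor-≢-≢ (odd-adjacent (lipschitz-adjacent lip g k≢))
                            (χ-proper _ _ (cut⊆H _ _ (from ∈cut (g , k≢))))

    lip′ : Lipschitz k′
    lip′ i j g with k i ≟ k j
    ... | yes k≡ = raise-level (flip i) (flip j) k≡
    ... | no k≢ =
      subst (λ b → k′ i ≤ suc (raise b (k j))) (flip-cut g k≢) (raise-mono (flip i) (lip i j g))

    tight⊆tight′ : tight k ⊆ᴹ tight k′
    tight⊆tight′ i j t with g , e ← to ∈tight t = from ∈tight (g , (begin
      raise (flip i) (k i)        ≡⟨ cong (raise (flip i)) e ⟩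
      raise (flip i) (suc (k j))  ≡⟨ raise-suc (flip i) (k j) ⟩
      suc (raise (flip i) (k j))  ≡⟨ cong (λ b → suc (raise b (k j))) (flip-cut g k≢) ⟩
      suc (k′ j)                  ∎))
      where
      open ≡-Reasoning
      k≢ : k i ≢ k j
      k≢ = adjacent⇒≢ (inj₁ e)

    tight′≡tight : tight k′ ≡ tight k
    tight′≡tight = proj₂ facet (tight k′) (tight-isProperFace edge lip′) tight⊆tight′

    adjacent′⇒adjacent : ∀ {i j} → G ∋⟨ i , j ⟩ → Adjacent (k′ i) (k′ j) → Adjacent (k i) (k j)
    adjacent′⇒adjacent {i} {j} g (inj₁ e) =
      inj₁ (proj₂ (to ∈tight (subst (_∋⟨ i , j ⟩) tight′≡tight (from ∈tight (g , e)))))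
    adjacent′⇒adjacent {i} {j} g (inj₂ e) =
      inj₂ (proj₂ (to ∈tight (subst (_∋⟨ j , i ⟩) tight′≡tight (from ∈tight (symmetric i j g , e)))))

    -- A level edge of H gets different flips at its ends, so it becomes tight for k′, hence for k.
    H⊆cut : H ⊆ᴹ cut k
    H⊆cut i j h with k i ≟ k j
    ... | no k≢ = from ∈cut (H⊆G i j h , k≢)
    ... | yes k≡ = contradiction k≡ (adjacent⇒≢ (adjacent′⇒adjacent (H⊆G i j h) (raise-≢ flip≢ k≡)))
      where
      flip≢ : flip i ≢ flip j
      flip≢ = χ-proper i j h ∘ xor-cancelˡ (odd (k i))
            ∘ subst (λ m → flip i ≡ odd m xor χ j) (sym k≡)

  facet-cut-isMaximalBipartite : ∀ {k} → HasEdge G → Lipschitz k → IsFacet G (tight k) →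
    IsMaximalBipartiteSubgraph G (cut k)
  facet-cut-isMaximalBipartite {k} edge lip facet = cut-isSubgraph k , cut-isBipartite lip ,
    λ { H (_ , H⊆G) (χ , χ-proper) cut⊆H →
          Recolouring.H⊆cut edge lip facet {H} H⊆G χ χ-proper cut⊆H ⊆ᴹ-antisym cut⊆H }

  offset-tight⊆ : ∀ {k₁ k₂ c₁ c₂} → (∀ v → k₁ v + c₂ ≡ k₂ v + c₁) → tight k₁ ⊆ᴹ tight k₂
  offset-tight⊆ {k₁} {k₂} {c₁} {c₂} aligned i j t with g , e ← to ∈tight t =
    from ∈tight (g , +-cancelʳ-≡ c₁ _ _ (begin
      k₂ i + c₁        ≡⟨ aligned i ⟨
      k₁ i + c₂        ≡⟨ cong (_+ c₂) e ⟩
      suc (k₁ j + c₂)  ≡⟨ cong suc (aligned j) ⟩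
      suc (k₂ j + c₁)  ∎))
    where open ≡-Reasoning

  cut-level : ∀ {k₁ k₂ u v} → cut k₁ ≡ cut k₂ → G ∋⟨ u , v ⟩ → k₁ u ≡ k₁ v → k₂ u ≡ k₂ v
  cut-level {k₂ = k₂} {u} {v} same-cut g k₁≡ = decidable-stable (k₂ u ≟ k₂ v) λ k₂≢ →
    proj₂ (to ∈cut (subst (_∋⟨ u , v ⟩) (sym same-cut) (from ∈cut (g , k₂≢)))) k₁≡

  module Comparison (connected : IsConnected G) (r : V)
                    {k₁ k₂} (lip₁ : Lipschitz k₁) (lip₂ : Lipschitz k₂) (same-cut : cut k₁ ≡ cut k₂)
                    (same-half : ∀ v → half (level₄ k₁ r v) ≡ half (level₄ k₂ r v)) where

    -- A v ≡ B v says that k₁ v − k₁ r = k₂ v − k₂ r.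
    A B : V → ℕ
    A v = k₁ v + k₂ r
    B v = k₂ v + k₁ r

    shift : ℕ
    shift = (k₁ r + k₂ r) * 3

    same-half-shifted : ∀ v → half (residue (A v + shift)) ≡ half (residue (B v + shift))
    same-half-shifted v = begin
      half (residue (A v + shift))              ≡⟨ cong half (residue-rebase (k₁ v) (k₁ r) (k₂ r)) ⟨
      half (level₄ k₁ r v)                      ≡⟨ same-half v ⟩
      half (level₄ k₂ r v)                      ≡⟨ cong half (residue-rebase (k₂ v) (k₂ r) (k₁ r)) ⟩
      half (residue (B v + (k₂ r + k₁ r) * 3))  ≡⟨ cong (λ s → half (residue (B v + s * 3))) k₂r+k₁r≡ ⟩
      half (residue (B v + shift))              ∎
      where
      open ≡-Reasoning
      k₂r+k₁r≡ : k₂ r + k₁ r ≡ k₁ r + k₂ r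
      k₂r+k₁r≡ = +-comm (k₂ r) (k₁ r)

    common-neighbour⇒aligned : ∀ {a v} → Adjacent a (A v) → Adjacent a (B v) → A v ≡ B v
    common-neighbour⇒aligned {v = v} adjA adjB with adjacent-coincide adjA adjB
    ... | inj₁ Av≡Bv = Av≡Bv
    ... | inj₂ (inj₁ Av≡2+Bv) =
      contradiction (same-half-shifted v) (half-residue-2+ (cong (_+ shift) Av≡2+Bv))
    ... | inj₂ (inj₂ Bv≡2+Av) =
      contradiction (sym (same-half-shifted v)) (half-residue-2+ (cong (_+ shift) Bv≡2+Av))

    aligned-step : ∀ {u v} → G ∋⟨ u , v ⟩ → A u ≡ B u → A v ≡ B v
    aligned-step {u} {v} g Au≡Bu with k₁ u ≟ k₁ v
    ... | yes k₁≡ = begin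
      A v  ≡⟨ cong (_+ k₂ r) k₁≡ ⟨
      A u  ≡⟨ Au≡Bu ⟩
      B u  ≡⟨ cong (_+ k₁ r) (cut-level same-cut g k₁≡) ⟩
      B v  ∎
      where open ≡-Reasoning
    ... | no k₁≢ = common-neighbour⇒aligned
      (subst (λ a → Adjacent a (A v)) Au≡Bu (adjacent-+ (k₂ r) (lipschitz-adjacent lip₁ g k₁≢)))
      (adjacent-+ (k₁ r) (lipschitz-adjacent lip₂ g (k₁≢ ∘ cut-level (sym same-cut) g)))

    aligned : ∀ v → A v ≡ B v
    aligned v = walk (connected r v) (+-comm (k₁ r) (k₂ r))
      where
      walk : ∀ {u v} → Star (Adj G) u v → A u ≡ B u → A v ≡ B v
      walk ε = id
      walk (g ◅ path) = walk path ∘ aligned-step g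

    tight-determined : tight k₁ ≡ tight k₂
    tight-determined = offset-tight⊆ aligned ⊆ᴹ-antisym offset-tight⊆ (sym ∘ aligned)

halves : ∀ {n} → (Fin (suc n) → ℕ) → Fin (2 ^ n)
halves k = funToFin λ i → half (level₄ k zero (suc i))

halves-injective : ∀ {n} (k₁ k₂ : Fin (suc n) → ℕ) → halves k₁ ≡ halves k₂ →
  ∀ v → half (level₄ k₁ zero v) ≡ half (level₄ k₂ zero v)
halves-injective k₁ k₂ _ zero = cong half (trans (level₄-root k₁ zero) (sym (level₄-root k₂ zero)))
halves-injective k₁ k₂ eq (suc i) = begin
  half (level₄ k₁ zero (suc i))  ≡⟨ finToFun-funToFin _ i ⟨
  finToFun (halves k₁) i         ≡⟨ cong (λ c → finToFun c i) eq ⟩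
  finToFun (halves k₂) i         ≡⟨ finToFun-funToFin _ i ⟩
  half (level₄ k₂ zero (suc i))  ∎
  where open ≡-Reasoning

mainTheorem8 : (N : ℕ) (G : Mat N) → IsSimple G → IsConnected G → HasEdge G →
    (Bs : List (Mat N)) → Unique Bs → (∀ H → H ∈ Bs ⇔ IsMaximalBipartiteSubgraph G H) →
    (Fs : List (Mat N)) → Unique Fs → All (IsFacet G) Fs →
    length Fs ≤ length Bs * 2 ^ (N ∸ 1)
mainTheorem8 zero _ _ _ (() , _)
mainTheorem8 (suc n) G simple connected edge Bs _ isMaximalBipartite Fs unique facets =
  unique⇒length≤ unique code code-faithful
  where
  open Potentials G simple
  open PotentialOf

  facet : ∀ p → IsFacet G (List.lookup Fs p)
  facet p = All.lookup facets (∈-lookup p)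

  potential : ∀ p → PotentialOf (List.lookup Fs p)
  potential p = facet⇒potential edge (facet p)

  cut∈Bs : ∀ p → cut (potential p .k) ∈ Bs
  cut∈Bs p = from (isMaximalBipartite _) (facet-cut-isMaximalBipartite edge (potential p .lipschitz)
    (subst (IsFacet G) (sym (potential p .tight-k≡F)) (facet p)))

  code : Fin (length Fs) → Fin (length Bs * 2 ^ n)
  code p = combine (index (cut∈Bs p)) (halves (potential p .k))

  code-faithful : ∀ {p q} → code p ≡ code q → List.lookup Fs p ≡ List.lookup Fs q
  code-faithful {p} {q} eq with same-index , same-halves ← combine-injective _ _ _ _ eq = begin
    List.lookup Fs p        ≡⟨ potential p .tight-k≡F ⟨
    tight (potential p .k)  ≡⟨ Comparison.tight-determined connected zero
                                 (potential p .lipschitz) (potential q .lipschitz)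
                                 (∈-index-injective (cut∈Bs p) (cut∈Bs q) same-index)
                                 (halves-injective (potential p .k) (potential q .k) same-halves) ⟩
    tight (potential q .k)  ≡⟨ potential q .tight-k≡F ⟩
    List.lookup Fs q        ∎
    where open ≡-Reasoning
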